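{- Let $m>0$ be an integer, $s$ a parameter, and $$l_n(x,m,s)=\sum_{k=0}^{\lfloor n/2\rfloor}\frac{n!}{k!\,(n-2k)!}\,\frac{1}{\prod_{j=1}^{k}(m+n-j)}\,s^k x^{n-2k}.$$ Then, as formal power series in $z$, $$\sum_{n\ge 0}l_n(x,m,s)\binom{n+m-1}{m-1}z^n=\frac{1}{(1-xz-sz^2)^m}=\Big(\sum_{n\ge0}l_n(x,1,s)z^n\Big)^m.$$
   Context: Empty products equal $1$. -}

module Defs where

open import Data.Nat as ℕ using (ℕ; zero; suc; _∸_; ⌊_/2⌋; _!)
open import Data.Nat.Combinatorics using (_C_)
open import Data.Integer using (+_)
open import Data.Rational using (ℚ; 0ℚ; 1ℚ; _+_; _*_; _-_; _/_)

_^ᵠ_ : ℚ → ℕ → ℚ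
x ^ᵠ zero  = 1ℚ
x ^ᵠ suc n = x * (x ^ᵠ n)

fromℕ : ℕ → ℚ
fromℕ n = (+ n) / 1

-- a / d as a rational; d = 0 never occurs in our uses (denominators are
-- positive products), the value 0 for d = 0 is an irrelevant convention
frac : ℕ → ℕ → ℚ
frac a zero    = 0ℚ
frac a (suc d) = (+ a) / suc d

sumUpTo : ℕ → (ℕ → ℚ) → ℚ
sumUpTo zero    f = f 0
sumUpTo (suc n) f = sumUpTo n f + f (suc n)

prodℕ : ℕ → (ℕ → ℕ) → ℕ
prodℕ zero    f = 1
prodℕ (suc k) f = prodℕ k f ℕ.* f (suc k)

PowerSeries : Set
PowerSeries = ℕ → ℚ

_*ₛ_ : PowerSeries → PowerSeries → PowerSeries
(f *ₛ g) n = sumUpTo n (λ i → f i * g (n ∸ i))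

oneₛ : PowerSeries
oneₛ zero    = 1ℚ
oneₛ (suc _) = 0ℚ

_^ₛ_ : PowerSeries → ℕ → PowerSeries
f ^ₛ zero  = oneₛ
f ^ₛ suc m = f *ₛ (f ^ₛ m)

denomPoly : ℚ → ℚ → PowerSeries
denomPoly x s zero                = 1ℚ
denomPoly x s (suc zero)          = 0ℚ - x
denomPoly x s (suc (suc zero))    = 0ℚ - s
denomPoly x s (suc (suc (suc _))) = 0ℚ

l : ℕ → ℚ → ℕ → ℚ → ℚ
l n x m s = sumUpTo ⌊ n /2⌋ (λ k →
  frac (n !) ((k !) ℕ.* ((n ∸ 2 ℕ.* k) !))
  * frac 1 (prodℕ k (λ j → (m ℕ.+ n) ∸ j))
  * (s ^ᵠ k) * (x ^ᵠ (n ∸ 2 ℕ.* k)))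

lhsSeries : ℚ → ℕ → ℚ → PowerSeries
lhsSeries x m s n = l n x m s * fromℕ ((n ℕ.+ m ∸ 1) C (m ∸ 1))

l1Series : ℚ → ℚ → PowerSeries
l1Series x s n = l n x 1 s

-- Write D = 1 - x z - s z².  Expanding D^(-M) = Σ_j C(M+j-1, j) (x z + s z²)^j by the binomial
-- theorem gives c_M(n) = Σ_k C(M+n-k-1, n-k) C(n-k, k) s^k x^(n-2k) as the coefficients of D^(-M).
-- Pascal's rule for both binomials is exactly the recurrence c_(M+1) = c_M + (x z + s z²) c_(M+1),
-- i.e. c_(M+1) D = c_M; with c_0 = 1 this gives c_M D^M = 1 without ever dividing by D.  A factorial
-- computation identifies l_n(x,m,s) C(n+m-1, m-1) with c_m(n).  Finally c_1^m D^m = (c_1 D)^m = 1,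
-- and inverses in a commutative monoid are unique, so c_m = c_1^m.
module Submission where

open import Defs
open import Data.Nat.Base as ℕ using (ℕ; zero; suc; _∸_; _≤_; _<_; z≤n; s≤s; _!; ⌊_/2⌋; NonZero)
import Data.Nat.Properties as ℕ
open import Data.Nat.Combinatorics using (_C_; k>n⇒nCk≡0; nCk+nC[k+1]≡[n+1]C[k+1])
open import Data.Nat.Combinatorics.Base using (_P′_)
open import Data.Product using (_×_; _,_)
open import Data.Sum using (inj₁; inj₂)
open import Relation.Nullary using (yes; no)
open import Function using (_∘_)
open import Relation.Binary.PropositionalEquality
  using (_≡_; refl; sym; trans; cong; cong₂; subst; _≗_; module ≡-Reasoning)

module _ where

  open import Data.Nat.Base using (_+_; _*_)
  open import Data.Nat.Properties
  open import Data.Nat.Combinatorics using (nCk≡n!/k![n-k]!; k![n∸k]!∣n!; nCn≡1)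
  open import Data.Nat.Combinatorics.Specification using (nP′k≡n!/[n∸k]!)
  open import Data.Nat.Divisibility using (m≤n⇒m!∣n!)
  open import Data.Nat.DivMod using (m/n*n≡m)
  open import Data.Nat.Solver using (module +-*-Solver)

  -- the number of size-j multisets from m elements, (m + j - 1) C j; Pascal's rule is built in
  multichoose : ℕ → ℕ → ℕ
  multichoose zero    zero    = 1
  multichoose zero    (suc j) = 0
  multichoose (suc m) zero    = 1
  multichoose (suc m) (suc j) = multichoose m (suc j) + multichoose (suc m) j

  multichoose-zeroʳ : ∀ m → multichoose m 0 ≡ 1
  multichoose-zeroʳ zero    = refl
  multichoose-zeroʳ (suc m) = refl

  suc-multichoose : ∀ m j → multichoose (suc m) j ≡ (m + j) C j
  suc-multichoose m       zero    = refl
  suc-multichoose zero    (suc j) = trans (suc-multichoose zero j) (trans (nCn≡1 j) (sym (nCn≡1 (suc j))))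
  suc-multichoose (suc m) (suc j) = begin
    multichoose (suc m) (suc j) + multichoose (suc (suc m)) j
      ≡⟨ cong₂ _+_ (suc-multichoose m (suc j)) (suc-multichoose (suc m) j) ⟩
    (m + suc j) C suc j + suc (m + j) C j
      ≡⟨ cong (λ i → (m + suc j) C suc j + i C j) (sym (+-suc m j)) ⟩
    (m + suc j) C suc j + (m + suc j) C j
      ≡⟨ +-comm ((m + suc j) C suc j) _ ⟩
    (m + suc j) C j + (m + suc j) C suc j
      ≡⟨ nCk+nC[k+1]≡[n+1]C[k+1] (m + suc j) j ⟩
    suc (m + suc j) C suc j ∎
    where open ≡-Reasoning

  nCk*k![n∸k]!≡n! : ∀ {n k} → k ≤ n → (n C k) * (k ! * (n ∸ k) !) ≡ n !
  nCk*k![n∸k]!≡n! {n} {k} k≤n = trans (cong (_* (k ! * (n ∸ k) !)) (nCk≡n!/k![n-k]! k≤n))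
    (m/n*n≡m {{k !* (n ∸ k) !≢0}} (k![n∸k]!∣n! k≤n))

  nP′k*[n∸k]!≡n! : ∀ {n k} → k ≤ n → (n P′ k) * (n ∸ k) ! ≡ n !
  nP′k*[n∸k]!≡n! {n} {k} k≤n = trans (cong (_* (n ∸ k) !) (nP′k≡n!/[n∸k]! k≤n))
    (m/n*n≡m {{(n ∸ k) !≢0}} (m≤n⇒m!∣n! (m∸n≤m n k)))

  nP′k≢0 : ∀ {n k} → k ≤ n → NonZero (n P′ k)
  nP′k≢0 {n} {k} k≤n = m*n≢0⇒m≢0 (n P′ k) {{subst NonZero (sym (nP′k*[n∸k]!≡n! k≤n)) (n !≢0)}}

  prodℕ-falling : ∀ n k → prodℕ k (λ j → suc n ∸ j) ≡ n P′ k
  prodℕ-falling n zero    = refl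
  prodℕ-falling n (suc k) = trans (cong (_* (n ∸ k)) (prodℕ-falling n k)) (*-comm (n P′ k) (n ∸ k))

  n∸2k≡n∸k∸k : ∀ n k → n ∸ 2 * k ≡ n ∸ k ∸ k
  n∸2k≡n∸k∸k n k = trans (cong (λ i → n ∸ (k + i)) (+-identityʳ k)) (sym (∸-+-assoc n k k))

  -- n!/(k!(n-2k)!) · C(n+m,m)/(m+n)(m+n-1)⋯(m+n-k+1) = C(m+n-k,n-k) · C(n-k,k), cleared of
  -- denominators; multiplied by m!, both sides become (m+n)!.
  binomial-falling-identity : ∀ m n k → k + k ≤ n →
    n ! * ((n + m) C m) ≡
    multichoose (suc m) (n ∸ k) * ((n ∸ k) C k) * (k ! * (n ∸ 2 * k) ! * ((m + n) P′ k))
  binomial-falling-identity m n k 2k≤n = *-cancelʳ-≡ _ _ (m !) {{m !≢0}} (trans lhs≡ (sym rhs≡))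
    where
    open ≡-Reasoning
    open +-*-Solver
    j = n ∸ k
    k≤n : k ≤ n
    k≤n = ≤-trans (m≤m+n k k) 2k≤n
    k≤j : k ≤ j
    k≤j = subst (_≤ j) (m+n∸m≡n k k) (∸-monoˡ-≤ k 2k≤n)
    lhs≡ : n ! * ((n + m) C m) * m ! ≡ (m + n) !
    lhs≡ = begin
      n ! * ((n + m) C m) * m !
        ≡⟨ solve 3 (λ a b c → a :* b :* c := b :* (c :* a)) refl (n !) ((n + m) C m) (m !) ⟩
      ((n + m) C m) * (m ! * n !)          ≡⟨ cong (λ i → ((n + m) C m) * (m ! * i !)) (m+n∸n≡m n m) ⟨
      ((n + m) C m) * (m ! * (n + m ∸ m) !) ≡⟨ nCk*k![n∸k]!≡n! (m≤n+m m n) ⟩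
      (n + m) !                          ≡⟨ cong _! (+-comm n m) ⟩
      (m + n) !                          ∎
    rhs≡ : multichoose (suc m) j * (j C k) * (k ! * (n ∸ 2 * k) ! * ((m + n) P′ k)) * m ! ≡ (m + n) !
    rhs≡ = begin
      multichoose (suc m) j * (j C k) * (k ! * (n ∸ 2 * k) ! * ((m + n) P′ k)) * m !
        ≡⟨ cong₂ (λ a b → a * (j C k) * (k ! * b ! * ((m + n) P′ k)) * m !)
             (suc-multichoose m j) (n∸2k≡n∸k∸k n k) ⟩
      ((m + j) C j) * (j C k) * (k ! * (j ∸ k) ! * ((m + n) P′ k)) * m !
        ≡⟨ solve 6 (λ a b c d e f → a :* b :* (c :* d :* e) :* f := a :* ((b :* (c :* d)) :* f) :* e) refl
             ((m + j) C j) (j C k) (k !) ((j ∸ k) !) ((m + n) P′ k) (m !) ⟩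
      ((m + j) C j) * ((j C k) * (k ! * (j ∸ k) !) * m !) * ((m + n) P′ k)
        ≡⟨ cong (λ i → ((m + j) C j) * (i * m !) * ((m + n) P′ k)) (nCk*k![n∸k]!≡n! k≤j) ⟩
      ((m + j) C j) * (j ! * m !) * ((m + n) P′ k)
        ≡⟨ cong (λ i → ((m + j) C j) * (j ! * i !) * ((m + n) P′ k)) (m+n∸n≡m m j) ⟨
      ((m + j) C j) * (j ! * (m + j ∸ j) !) * ((m + n) P′ k)
        ≡⟨ cong (_* ((m + n) P′ k)) (nCk*k![n∸k]!≡n! (m≤n+m j m)) ⟩
      (m + j) ! * ((m + n) P′ k)
        ≡⟨ cong (λ i → i ! * ((m + n) P′ k)) (+-∸-assoc m k≤n) ⟨
      (m + n ∸ k) ! * ((m + n) P′ k)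
        ≡⟨ *-comm ((m + n ∸ k) !) _ ⟩
      ((m + n) P′ k) * (m + n ∸ k) !
        ≡⟨ nP′k*[n∸k]!≡n! (≤-trans k≤n (m≤n+m n m)) ⟩
      (m + n) ! ∎

  k≤⌊n/2⌋⇒k+k≤n : ∀ {n k} → k ≤ ⌊ n /2⌋ → k + k ≤ n
  k≤⌊n/2⌋⇒k+k≤n {n} k≤n/2 =
    subst (_ ≤_) (⌊n/2⌋+⌈n/2⌉≡n n) (+-mono-≤ k≤n/2 (≤-trans k≤n/2 (⌊n/2⌋≤⌈n/2⌉ n)))

  k+k≤n⇒k≤⌊n/2⌋ : ∀ {n k} → k + k ≤ n → k ≤ ⌊ n /2⌋
  k+k≤n⇒k≤⌊n/2⌋ {n} {k} k+k≤n = subst (_≤ ⌊ n /2⌋) (sym (n≡⌊n+n/2⌋ k)) (⌊n/2⌋-mono k+k≤n)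

  ⌊n/2⌋<k⇒[n∸k]Ck≡0 : ∀ {n k} → k ≤ n → ⌊ n /2⌋ < k → (n ∸ k) C k ≡ 0
  ⌊n/2⌋<k⇒[n∸k]Ck≡0 {n} {k} k≤n n/2<k =
    k>n⇒nCk≡0 (subst (n ∸ k <_) (m+n∸m≡n k k) (∸-monoˡ-< n<k+k k≤n))
    where
    n<k+k : n < k + k
    n<k+k = ≰⇒> (λ k+k≤n → <⇒≱ n/2<k (k+k≤n⇒k≤⌊n/2⌋ k+k≤n))

import Data.Integer.Base as ℤ
import Data.Integer.Properties as ℤ
open import Data.Rational using (ℚ; 0ℚ; 1ℚ; _+_; _*_; _-_; fromℚᵘ; toℚᵘ)
open import Data.Rational.Unnormalised as ℚᵘ using (mkℚᵘ; *≡*)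
import Data.Rational.Unnormalised.Properties as ℚᵘ
open import Data.Rational.Properties
  using (fromℚᵘ-cong; fromℚᵘ-toℚᵘ; toℚᵘ-fromℚᵘ; toℚᵘ-homo-+; toℚᵘ-homo-*;
         +-assoc; +-comm; +-identityʳ; *-assoc; *-comm; *-identityˡ; *-identityʳ;
         *-zeroˡ; *-distribˡ-+; +-0-commutativeMonoid)
open import Data.Rational.Solver using (module +-*-Solver)
open +-*-Solver using (solve; _:+_; _:*_; _:-_; _:=_; con)
open import Algebra.Bundles using (CommutativeMonoid)
open import Level using (0ℓ)
open import Algebra.Properties.CommutativeSemigroup
  (CommutativeMonoid.commutativeSemigroup +-0-commutativeMonoid)
  using () renaming (interchange to +-interchange)

sumUpTo-cong : ∀ n {f g : ℕ → ℚ} → (∀ i → i ≤ n → f i ≡ g i) → sumUpTo n f ≡ sumUpTo n g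
sumUpTo-cong zero    f≡g = f≡g 0 z≤n
sumUpTo-cong (suc n) f≡g =
  cong₂ _+_ (sumUpTo-cong n (λ i i≤n → f≡g i (ℕ.m≤n⇒m≤1+n i≤n))) (f≡g (suc n) ℕ.≤-refl)

sumUpTo-zero : ∀ n (f : ℕ → ℚ) → (∀ i → i ≤ n → f i ≡ 0ℚ) → sumUpTo n f ≡ 0ℚ
sumUpTo-zero n f f≡0 = trans (sumUpTo-cong n f≡0) (sumUpTo-const0 n)
  where
  sumUpTo-const0 : ∀ n → sumUpTo n (λ _ → 0ℚ) ≡ 0ℚ
  sumUpTo-const0 zero    = refl
  sumUpTo-const0 (suc n) = trans (+-identityʳ _) (sumUpTo-const0 n)

sumUpTo-sucˡ : ∀ n (f : ℕ → ℚ) → sumUpTo (suc n) f ≡ f 0 + sumUpTo n (f ∘ suc)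
sumUpTo-sucˡ zero    f = refl
sumUpTo-sucˡ (suc n) f = begin
  sumUpTo (suc n) f + f (2 ℕ.+ n)               ≡⟨ cong (_+ f (2 ℕ.+ n)) (sumUpTo-sucˡ n f) ⟩
  (f 0 + sumUpTo n (f ∘ suc)) + f (2 ℕ.+ n)     ≡⟨ +-assoc (f 0) _ _ ⟩
  f 0 + sumUpTo (suc n) (f ∘ suc)               ∎
  where open ≡-Reasoning

sumUpTo-distrib-+ : ∀ n (f g : ℕ → ℚ) →
  sumUpTo n (λ i → f i + g i) ≡ sumUpTo n f + sumUpTo n g
sumUpTo-distrib-+ zero    f g = refl
sumUpTo-distrib-+ (suc n) f g = begin
  sumUpTo n (λ i → f i + g i) + (f (suc n) + g (suc n))
    ≡⟨ cong (_+ (f (suc n) + g (suc n))) (sumUpTo-distrib-+ n f g) ⟩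
  (sumUpTo n f + sumUpTo n g) + (f (suc n) + g (suc n))
    ≡⟨ +-interchange (sumUpTo n f) (sumUpTo n g) (f (suc n)) (g (suc n)) ⟩
  (sumUpTo n f + f (suc n)) + (sumUpTo n g + g (suc n)) ∎
  where open ≡-Reasoning

*-distribˡ-sumUpTo : ∀ n a (f : ℕ → ℚ) → a * sumUpTo n f ≡ sumUpTo n (λ i → a * f i)
*-distribˡ-sumUpTo zero    a f = refl
*-distribˡ-sumUpTo (suc n) a f =
  trans (*-distribˡ-+ a (sumUpTo n f) (f (suc n))) (cong (_+ a * f (suc n)) (*-distribˡ-sumUpTo n a f))

*-distribʳ-sumUpTo : ∀ n a (f : ℕ → ℚ) → sumUpTo n f * a ≡ sumUpTo n (λ i → f i * a)
*-distribʳ-sumUpTo n a f = begin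
  sumUpTo n f * a               ≡⟨ *-comm (sumUpTo n f) a ⟩
  a * sumUpTo n f               ≡⟨ *-distribˡ-sumUpTo n a f ⟩
  sumUpTo n (λ i → a * f i)     ≡⟨ sumUpTo-cong n (λ i _ → *-comm a (f i)) ⟩
  sumUpTo n (λ i → f i * a)     ∎
  where open ≡-Reasoning

sumUpTo-+-* : ∀ n a (f g : ℕ → ℚ) → sumUpTo n (λ i → f i + a * g i) ≡ sumUpTo n f + a * sumUpTo n g
sumUpTo-+-* n a f g =
  trans (sumUpTo-distrib-+ n f (λ i → a * g i)) (cong (sumUpTo n f +_) (sym (*-distribˡ-sumUpTo n a g)))

sumUpTo-reverse : ∀ n (f : ℕ → ℚ) → sumUpTo n f ≡ sumUpTo n (λ i → f (n ∸ i))
sumUpTo-reverse zero    f = refl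
sumUpTo-reverse (suc n) f = begin
  sumUpTo n f + f (suc n)                    ≡⟨ +-comm (sumUpTo n f) (f (suc n)) ⟩
  f (suc n) + sumUpTo n f                    ≡⟨ cong (f (suc n) +_) (sumUpTo-reverse n f) ⟩
  f (suc n) + sumUpTo n (λ i → f (n ∸ i))    ≡⟨ sumUpTo-sucˡ n (λ i → f (suc n ∸ i)) ⟨
  sumUpTo (suc n) (λ i → f (suc n ∸ i))      ∎
  where open ≡-Reasoning

sumUpTo-extend : ∀ {h} n (f : ℕ → ℚ) → h ≤ n → (∀ k → h < k → k ≤ n → f k ≡ 0ℚ) →
  sumUpTo h f ≡ sumUpTo n f
sumUpTo-extend zero    f z≤n f≡0 = refl
sumUpTo-extend {h} (suc n) f h≤1+n f≡0 with ℕ.m≤n⇒m<n∨m≡n h≤1+n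
... | inj₂ refl = refl
... | inj₁ (s≤s h≤n) = begin
  sumUpTo h f               ≡⟨ sumUpTo-extend n f h≤n (λ k h<k k≤n → f≡0 k h<k (ℕ.m≤n⇒m≤1+n k≤n)) ⟩
  sumUpTo n f               ≡⟨ +-identityʳ (sumUpTo n f) ⟨
  sumUpTo n f + 0ℚ          ≡⟨ cong (sumUpTo n f +_) (f≡0 (suc n) (s≤s h≤n) ℕ.≤-refl) ⟨
  sumUpTo n f + f (suc n)   ∎
  where open ≡-Reasoning

sumUpTo-triangle : ∀ n (F : ℕ → ℕ → ℚ) →
  sumUpTo n (λ i → sumUpTo i (λ j → F j i)) ≡ sumUpTo n (λ j → sumUpTo (n ∸ j) (λ k → F j (j ℕ.+ k)))
sumUpTo-triangle zero    F = refl
sumUpTo-triangle (suc n) F = begin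
  sumUpTo n (λ i → sumUpTo i (λ j → F j i)) + sumUpTo (suc n) (λ j → F j (suc n))
    ≡⟨ cong (_+ sumUpTo (suc n) (λ j → F j (suc n))) (sumUpTo-triangle n F) ⟩
  Rows n + (sumUpTo n (λ j → F j (suc n)) + F (suc n) (suc n))
    ≡⟨ +-assoc (Rows n) _ _ ⟨
  (Rows n + sumUpTo n (λ j → F j (suc n))) + F (suc n) (suc n)
    ≡⟨ cong (_+ F (suc n) (suc n)) (sumUpTo-distrib-+ n (row n) (λ j → F j (suc n))) ⟨
  sumUpTo n (λ j → row n j + F j (suc n)) + F (suc n) (suc n)
    ≡⟨ cong₂ _+_ (sumUpTo-cong n extend-row) (sym (last-row n)) ⟩
  Rows (suc n) ∎
  where
  open ≡-Reasoning
  row : ℕ → ℕ → ℚ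
  row n j = sumUpTo (n ∸ j) (λ k → F j (j ℕ.+ k))
  Rows : ℕ → ℚ
  Rows n = sumUpTo n (row n)
  extend-row : ∀ j → j ≤ n → row n j + F j (suc n) ≡ row (suc n) j
  extend-row j j≤n rewrite ℕ.+-∸-assoc 1 j≤n =
    cong (λ i → row n j + F j i) (sym (trans (ℕ.+-suc j (n ∸ j)) (cong suc (ℕ.m+[n∸m]≡n j≤n))))
  last-row : ∀ n → row (suc n) (suc n) ≡ F (suc n) (suc n)
  last-row n rewrite ℕ.n∸n≡0 n = cong (F (suc n)) (ℕ.+-identityʳ (suc n))

antidiagonal : ℕ → (ℕ → ℕ → ℚ) → ℚ
antidiagonal n F = sumUpTo n (λ k → F (n ∸ k) k)

antidiagonal-suc : ∀ n F → antidiagonal (suc n) F ≡ F (suc n) 0 + antidiagonal n (λ j k → F j (suc k))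
antidiagonal-suc n F = sumUpTo-sucˡ n (λ k → F (suc n ∸ k) k)

antidiagonal-shift : ∀ n F → (∀ k → F 0 (suc k) ≡ 0ℚ) → antidiagonal (suc n) F ≡ antidiagonal n (F ∘ suc)
antidiagonal-shift n F F0≡0 = begin
  sumUpTo n (λ k → F (suc n ∸ k) k) + F (n ∸ n) (suc n)   ≡⟨ cong₂ _+_ (sumUpTo-cong n shift) last ⟩
  antidiagonal n (F ∘ suc) + 0ℚ                          ≡⟨ +-identityʳ _ ⟩
  antidiagonal n (F ∘ suc)                               ∎
  where
  open ≡-Reasoning
  shift : ∀ k → k ≤ n → F (suc n ∸ k) k ≡ F (suc (n ∸ k)) k
  shift k k≤n = cong (λ j → F j k) (ℕ.+-∸-assoc 1 k≤n)
  last : F (n ∸ n) (suc n) ≡ 0ℚ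
  last rewrite ℕ.n∸n≡0 n = F0≡0 n

*ₛ-cong : ∀ {f f′ g g′} → f ≗ f′ → g ≗ g′ → (f *ₛ g) ≗ (f′ *ₛ g′)
*ₛ-cong f≗f′ g≗g′ n = sumUpTo-cong n (λ i _ → cong₂ _*_ (f≗f′ i) (g≗g′ (n ∸ i)))

*ₛ-comm : ∀ f g → (f *ₛ g) ≗ (g *ₛ f)
*ₛ-comm f g n = begin
  sumUpTo n (λ i → f i * g (n ∸ i))                 ≡⟨ sumUpTo-reverse n _ ⟩
  sumUpTo n (λ i → f (n ∸ i) * g (n ∸ (n ∸ i)))     ≡⟨ sumUpTo-cong n swap ⟩
  sumUpTo n (λ i → g i * f (n ∸ i))                 ∎
  where
  open ≡-Reasoning
  swap : ∀ i → i ≤ n → f (n ∸ i) * g (n ∸ (n ∸ i)) ≡ g i * f (n ∸ i)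
  swap i i≤n rewrite ℕ.m∸[m∸n]≡n i≤n = *-comm (f (n ∸ i)) (g i)

*ₛ-assoc : ∀ f g h → ((f *ₛ g) *ₛ h) ≗ (f *ₛ (g *ₛ h))
*ₛ-assoc f g h n = begin
  sumUpTo n (λ i → sumUpTo i (λ j → f j * g (i ∸ j)) * h (n ∸ i))
    ≡⟨ sumUpTo-cong n (λ i _ → *-distribʳ-sumUpTo i (h (n ∸ i)) _) ⟩
  sumUpTo n (λ i → sumUpTo i (λ j → (f j * g (i ∸ j)) * h (n ∸ i)))
    ≡⟨ sumUpTo-triangle n (λ j i → (f j * g (i ∸ j)) * h (n ∸ i)) ⟩
  sumUpTo n (λ j → sumUpTo (n ∸ j) (λ k → (f j * g ((j ℕ.+ k) ∸ j)) * h (n ∸ (j ℕ.+ k))))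
    ≡⟨ sumUpTo-cong n (λ j _ → sumUpTo-cong (n ∸ j) (λ k _ → reindex j k)) ⟩
  sumUpTo n (λ j → sumUpTo (n ∸ j) (λ k → f j * (g k * h ((n ∸ j) ∸ k))))
    ≡⟨ sumUpTo-cong n (λ j _ → *-distribˡ-sumUpTo (n ∸ j) (f j) _) ⟨
  sumUpTo n (λ j → f j * sumUpTo (n ∸ j) (λ k → g k * h ((n ∸ j) ∸ k))) ∎
  where
  open ≡-Reasoning
  reindex : ∀ j k → (f j * g ((j ℕ.+ k) ∸ j)) * h (n ∸ (j ℕ.+ k)) ≡ f j * (g k * h ((n ∸ j) ∸ k))
  reindex j k rewrite ℕ.m+n∸m≡n j k | ℕ.∸-+-assoc n j k = *-assoc (f j) (g k) _

*ₛ-identityˡ : ∀ f → (oneₛ *ₛ f) ≗ f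
*ₛ-identityˡ f zero    = *-identityˡ (f 0)
*ₛ-identityˡ f (suc n) = begin
  sumUpTo (suc n) (λ i → oneₛ i * f (suc n ∸ i))       ≡⟨ sumUpTo-sucˡ n _ ⟩
  1ℚ * f (suc n) + sumUpTo n (λ i → 0ℚ * f (n ∸ i))    ≡⟨ cong₂ _+_ (*-identityˡ (f (suc n)))
                                                             (sumUpTo-zero n _ (λ i _ → *-zeroˡ (f (n ∸ i)))) ⟩
  f (suc n) + 0ℚ                                       ≡⟨ +-identityʳ (f (suc n)) ⟩
  f (suc n)                                            ∎
  where open ≡-Reasoning

*ₛ-identityʳ : ∀ f → (f *ₛ oneₛ) ≗ f
*ₛ-identityʳ f n = trans (*ₛ-comm f oneₛ n) (*ₛ-identityˡ f n)

*ₛ-oneₛ-commutativeMonoid : CommutativeMonoid 0ℓ 0ℓ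
*ₛ-oneₛ-commutativeMonoid = record
  { Carrier = PowerSeries
  ; _≈_ = _≗_
  ; _∙_ = _*ₛ_
  ; ε = oneₛ
  ; isCommutativeMonoid = record
    { isMonoid = record
      { isSemigroup = record
        { isMagma = record
          { isEquivalence = record
            { refl = λ _ → refl ; sym = λ p n → sym (p n) ; trans = λ p q n → trans (p n) (q n) }
          ; ∙-cong = *ₛ-cong
          }
        ; assoc = *ₛ-assoc
        }
      ; identity = *ₛ-identityˡ , *ₛ-identityʳ
      }
    ; comm = *ₛ-comm
    }
  }

module _ {c ℓ} (M : CommutativeMonoid c ℓ) where
  open CommutativeMonoid M using (_≈_; _∙_; ε; comm; ∙-congʳ; identityˡ; monoid; setoid)
    renaming (trans to ≈-trans)
  open import Algebra.Properties.Monoid monoid using (cancelʳ)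
  open import Relation.Binary.Reasoning.Setoid setoid

  inverse-unique : ∀ {a b d} → a ∙ d ≈ ε → b ∙ d ≈ ε → a ≈ b
  inverse-unique {a} {b} {d} a∙d≈ε b∙d≈ε = begin
    a            ≈⟨ cancelʳ (≈-trans (comm d b) b∙d≈ε) a ⟨
    (a ∙ d) ∙ b  ≈⟨ ∙-congʳ a∙d≈ε ⟩
    ε ∙ b        ≈⟨ identityˡ b ⟩
    b            ∎

^ₛ-*ₛ-inverse : ∀ {f g} m → (f *ₛ g) ≗ oneₛ → ((f ^ₛ m) *ₛ (g ^ₛ m)) ≗ oneₛ
^ₛ-*ₛ-inverse zero    fg≗1 = *ₛ-identityˡ oneₛ
^ₛ-*ₛ-inverse {f} {g} (suc m) fg≗1 = begin
  (f *ₛ (f ^ₛ m)) *ₛ (g *ₛ (g ^ₛ m))   ≈⟨ interchange f (f ^ₛ m) g (g ^ₛ m) ⟩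
  (f *ₛ g) *ₛ ((f ^ₛ m) *ₛ (g ^ₛ m))   ≈⟨ *ₛ-cong fg≗1 (^ₛ-*ₛ-inverse m fg≗1) ⟩
  oneₛ *ₛ oneₛ                         ≈⟨ *ₛ-identityˡ oneₛ ⟩
  oneₛ                                 ∎
  where
  open CommutativeMonoid *ₛ-oneₛ-commutativeMonoid using (setoid; commutativeSemigroup)
  open import Algebra.Properties.CommutativeSemigroup commutativeSemigroup using (interchange)
  open import Relation.Binary.Reasoning.Setoid setoid

denomPoly-*ₛ-tail : ∀ x s n (h : ℕ → ℚ) →
  sumUpTo n (λ i → denomPoly x s (2 ℕ.+ i) * h i) ≡ (0ℚ - s) * h 0
denomPoly-*ₛ-tail x s zero    h = refl
denomPoly-*ₛ-tail x s (suc n) h = begin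
  sumUpTo n (λ i → denomPoly x s (2 ℕ.+ i) * h i) + 0ℚ * h (suc n)
    ≡⟨ cong₂ _+_ (denomPoly-*ₛ-tail x s n h) (*-zeroˡ (h (suc n))) ⟩
  (0ℚ - s) * h 0 + 0ℚ
    ≡⟨ +-identityʳ _ ⟩
  (0ℚ - s) * h 0 ∎
  where open ≡-Reasoning

recurrence⇒denomPoly-*ₛ : ∀ x s {f g : PowerSeries} →
  f 0 ≡ g 0 → f 1 ≡ g 1 + x * f 0 → (∀ n → f (2 ℕ.+ n) ≡ g (2 ℕ.+ n) + x * f (1 ℕ.+ n) + s * f n) →
  (denomPoly x s *ₛ f) ≗ g
recurrence⇒denomPoly-*ₛ x s {f} {g} f₀ f₁ f₂₊ zero = trans (*-identityˡ (f 0)) f₀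
recurrence⇒denomPoly-*ₛ x s {f} {g} f₀ f₁ f₂₊ (suc zero) = begin
  1ℚ * f 1 + (0ℚ - x) * f 0
    ≡⟨ cong (λ t → 1ℚ * t + (0ℚ - x) * f 0) f₁ ⟩
  1ℚ * (g 1 + x * f 0) + (0ℚ - x) * f 0
    ≡⟨ solve 3 (λ g₁ f₀ x → con 1ℚ :* (g₁ :+ x :* f₀) :+ (con 0ℚ :- x) :* f₀ := g₁) refl (g 1) (f 0) x ⟩
  g 1 ∎
  where open ≡-Reasoning
recurrence⇒denomPoly-*ₛ x s {f} {g} f₀ f₁ f₂₊ (suc (suc n)) = begin
  sumUpTo (2 ℕ.+ n) (λ i → denomPoly x s i * f (2 ℕ.+ n ∸ i))
    ≡⟨ sumUpTo-sucˡ (suc n) _ ⟩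
  1ℚ * f (2 ℕ.+ n) + sumUpTo (suc n) (λ i → denomPoly x s (suc i) * f (suc n ∸ i))
    ≡⟨ cong (1ℚ * f (2 ℕ.+ n) +_) (sumUpTo-sucˡ n _) ⟩
  1ℚ * f (2 ℕ.+ n) + ((0ℚ - x) * f (suc n) + sumUpTo n (λ i → denomPoly x s (2 ℕ.+ i) * f (n ∸ i)))
    ≡⟨ cong₂ (λ a b → 1ℚ * a + ((0ℚ - x) * f (suc n) + b))
         (f₂₊ n) (denomPoly-*ₛ-tail x s n (λ i → f (n ∸ i))) ⟩
  1ℚ * (g (2 ℕ.+ n) + x * f (suc n) + s * f n) + ((0ℚ - x) * f (suc n) + (0ℚ - s) * f n)
    ≡⟨ solve 5 (λ g₂ f₁ f₀ x s → con 1ℚ :* (g₂ :+ x :* f₁ :+ s :* f₀)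
                                   :+ ((con 0ℚ :- x) :* f₁ :+ (con 0ℚ :- s) :* f₀) := g₂)
         refl (g (2 ℕ.+ n)) (f (suc n)) (f n) x s ⟩
  g (2 ℕ.+ n) ∎
  where open ≡-Reasoning

module _ where
  open import Data.Integer.Base using (+_)

  fromℚᵘ-homo-+ : ∀ p q → fromℚᵘ (p ℚᵘ.+ q) ≡ fromℚᵘ p + fromℚᵘ q
  fromℚᵘ-homo-+ p q = begin
    fromℚᵘ (p ℚᵘ.+ q)
      ≡⟨ fromℚᵘ-cong (ℚᵘ.+-cong (toℚᵘ-fromℚᵘ p) (toℚᵘ-fromℚᵘ q)) ⟨
    fromℚᵘ (toℚᵘ (fromℚᵘ p) ℚᵘ.+ toℚᵘ (fromℚᵘ q))
      ≡⟨ fromℚᵘ-cong (toℚᵘ-homo-+ (fromℚᵘ p) (fromℚᵘ q)) ⟨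
    fromℚᵘ (toℚᵘ (fromℚᵘ p + fromℚᵘ q))
      ≡⟨ fromℚᵘ-toℚᵘ (fromℚᵘ p + fromℚᵘ q) ⟩
    fromℚᵘ p + fromℚᵘ q ∎
    where open ≡-Reasoning

  fromℚᵘ-homo-* : ∀ p q → fromℚᵘ (p ℚᵘ.* q) ≡ fromℚᵘ p * fromℚᵘ q
  fromℚᵘ-homo-* p q = begin
    fromℚᵘ (p ℚᵘ.* q)
      ≡⟨ fromℚᵘ-cong (ℚᵘ.*-cong (toℚᵘ-fromℚᵘ p) (toℚᵘ-fromℚᵘ q)) ⟨
    fromℚᵘ (toℚᵘ (fromℚᵘ p) ℚᵘ.* toℚᵘ (fromℚᵘ q))
      ≡⟨ fromℚᵘ-cong (toℚᵘ-homo-* (fromℚᵘ p) (fromℚᵘ q)) ⟨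
    fromℚᵘ (toℚᵘ (fromℚᵘ p * fromℚᵘ q))
      ≡⟨ fromℚᵘ-toℚᵘ (fromℚᵘ p * fromℚᵘ q) ⟩
    fromℚᵘ p * fromℚᵘ q ∎
    where open ≡-Reasoning

  fromℕ-homo-+ : ∀ a b → fromℕ (a ℕ.+ b) ≡ fromℕ a + fromℕ b
  fromℕ-homo-+ a b =
    trans (fromℚᵘ-cong {mkℚᵘ (+ (a ℕ.+ b)) 0} {mkℚᵘ (+ a) 0 ℚᵘ.+ mkℚᵘ (+ b) 0} (*≡* cross))
          (fromℚᵘ-homo-+ (mkℚᵘ (+ a) 0) (mkℚᵘ (+ b) 0))
    where
    open ≡-Reasoning
    cross : + (a ℕ.+ b) ℤ.* + 1 ≡ (+ a ℤ.* + 1 ℤ.+ + b ℤ.* + 1) ℤ.* + 1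
    cross = begin
      + (a ℕ.+ b) ℤ.* + 1                   ≡⟨ ℤ.*-identityʳ _ ⟩
      + (a ℕ.+ b)                           ≡⟨ ℤ.pos-+ a b ⟩
      + a ℤ.+ + b                           ≡⟨ cong₂ ℤ._+_ (ℤ.*-identityʳ (+ a)) (ℤ.*-identityʳ (+ b)) ⟨
      + a ℤ.* + 1 ℤ.+ + b ℤ.* + 1           ≡⟨ ℤ.*-identityʳ _ ⟨
      (+ a ℤ.* + 1 ℤ.+ + b ℤ.* + 1) ℤ.* + 1 ∎

  fromℕ-homo-* : ∀ a b → fromℕ (a ℕ.* b) ≡ fromℕ a * fromℕ b
  fromℕ-homo-* a b =
    trans (fromℚᵘ-cong {mkℚᵘ (+ (a ℕ.* b)) 0} {mkℚᵘ (+ a) 0 ℚᵘ.* mkℚᵘ (+ b) 0}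
             (*≡* (cong (ℤ._* + 1) (ℤ.pos-* a b))))
          (fromℚᵘ-homo-* (mkℚᵘ (+ a) 0) (mkℚᵘ (+ b) 0))

  frac-*-frac-*-fromℕ : ∀ a b c g d e .{{_ : NonZero d}} .{{_ : NonZero e}} →
    a ℕ.* b ℕ.* c ≡ g ℕ.* (d ℕ.* e) → frac a d * frac b e * fromℕ c ≡ fromℕ g
  frac-*-frac-*-fromℕ a b c g (suc d) (suc e) abc≡gde = begin
    frac a (suc d) * frac b (suc e) * fromℕ c
      ≡⟨ cong (_* fromℕ c) (fromℚᵘ-homo-* (mkℚᵘ (+ a) d) (mkℚᵘ (+ b) e)) ⟨
    fromℚᵘ (mkℚᵘ (+ a) d ℚᵘ.* mkℚᵘ (+ b) e) * fromℕ c
      ≡⟨ fromℚᵘ-homo-* (mkℚᵘ (+ a) d ℚᵘ.* mkℚᵘ (+ b) e) (mkℚᵘ (+ c) 0) ⟨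
    fromℚᵘ (mkℚᵘ (+ a) d ℚᵘ.* mkℚᵘ (+ b) e ℚᵘ.* mkℚᵘ (+ c) 0)
      ≡⟨ fromℚᵘ-cong {mkℚᵘ (+ a) d ℚᵘ.* mkℚᵘ (+ b) e ℚᵘ.* mkℚᵘ (+ c) 0} {mkℚᵘ (+ g) 0}
           (*≡* cross) ⟩
    fromℕ g ∎
    where
    open ≡-Reasoning
    cross : (+ a ℤ.* + b) ℤ.* + c ℤ.* + 1 ≡ + g ℤ.* + (suc d ℕ.* suc e ℕ.* 1)
    cross = begin
      (+ a ℤ.* + b) ℤ.* + c ℤ.* + 1        ≡⟨ ℤ.*-identityʳ _ ⟩
      (+ a ℤ.* + b) ℤ.* + c                ≡⟨ cong (ℤ._* + c) (ℤ.pos-* a b) ⟨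
      + (a ℕ.* b) ℤ.* + c                  ≡⟨ ℤ.pos-* (a ℕ.* b) c ⟨
      + (a ℕ.* b ℕ.* c)                    ≡⟨ cong +_ abc≡gde ⟩
      + (g ℕ.* (suc d ℕ.* suc e))          ≡⟨ cong (λ n → + (g ℕ.* n)) (ℕ.*-identityʳ _) ⟨
      + (g ℕ.* (suc d ℕ.* suc e ℕ.* 1))    ≡⟨ ℤ.pos-* g _ ⟩
      + g ℤ.* + (suc d ℕ.* suc e ℕ.* 1)    ∎

fromℕ-pascal : ∀ j k → fromℕ (suc j C suc k) ≡ fromℕ (j C k) + fromℕ (j C suc k)
fromℕ-pascal j k = trans (cong fromℕ (sym (nCk+nC[k+1]≡[n+1]C[k+1] j k))) (fromℕ-homo-+ (j C k) (j C suc k))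

module _ (x s : ℚ) where

  -- term M j k is the coefficient of s^k x^(j-k) z^(j+k) in Σ_j multichoose M j (x z + s z²)^j;
  -- collected by degree they give the coefficients c_M(n) of (1 - x z - s z²)^(-M).
  term : ℕ → ℕ → ℕ → ℚ
  term M j k = fromℕ (multichoose M j) * fromℕ (j C k) * s ^ᵠ k * x ^ᵠ (j ∸ k)

  invDenomPoly^ : ℕ → PowerSeries
  invDenomPoly^ M n = antidiagonal n (term M)

  term-axis : ∀ M k → term M 0 (suc k) ≡ 0ℚ
  term-axis M k = solve 3 (λ a b c → a :* con 0ℚ :* b :* c := con 0ℚ) refl
    (fromℕ (multichoose M 0)) (s ^ᵠ suc k) (x ^ᵠ 0)

  term-pascal₀ : ∀ M j → term (suc M) (suc j) 0 ≡ term M (suc j) 0 + x * term (suc M) j 0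
  term-pascal₀ M j = begin
    fromℕ (multichoose M (suc j) ℕ.+ multichoose (suc M) j) * 1ℚ * 1ℚ * (x * x ^ᵠ j)
      ≡⟨ cong (λ a → a * 1ℚ * 1ℚ * (x * x ^ᵠ j))
           (fromℕ-homo-+ (multichoose M (suc j)) (multichoose (suc M) j)) ⟩
    (P + Q) * 1ℚ * 1ℚ * (x * x ^ᵠ j)
      ≡⟨ solve 4 (λ P Q x X → (P :+ Q) :* con 1ℚ :* con 1ℚ :* (x :* X)
                   := P :* con 1ℚ :* con 1ℚ :* (x :* X) :+ x :* (Q :* con 1ℚ :* con 1ℚ :* X))
           refl P Q x (x ^ᵠ j) ⟩
    P * 1ℚ * 1ℚ * (x * x ^ᵠ j) + x * (Q * 1ℚ * 1ℚ * x ^ᵠ j) ∎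
    where
    open ≡-Reasoning
    P = fromℕ (multichoose M (suc j))
    Q = fromℕ (multichoose (suc M) j)

  C-x^-shift : ∀ j k → fromℕ (j C suc k) * x ^ᵠ (j ∸ k) ≡ x * (fromℕ (j C suc k) * x ^ᵠ (j ∸ suc k))
  C-x^-shift j k with suc k ℕ.≤? j
  ... | yes k<j rewrite ℕ.+-∸-assoc 1 k<j =
    solve 3 (λ c x X → c :* (x :* X) := x :* (c :* X)) refl (fromℕ (j C suc k)) x (x ^ᵠ (j ∸ suc k))
  ... | no  k≮j rewrite k>n⇒nCk≡0 (ℕ.≰⇒> k≮j) =
    solve 3 (λ x X Y → con 0ℚ :* X := x :* (con 0ℚ :* Y)) refl x (x ^ᵠ (j ∸ k)) (x ^ᵠ (j ∸ suc k))

  term-pascal : ∀ M j k →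
    term (suc M) (suc j) (suc k) ≡ term M (suc j) (suc k) + x * term (suc M) j (suc k) + s * term (suc M) j k
  term-pascal M j k = begin
    fromℕ (multichoose M (suc j) ℕ.+ multichoose (suc M) j) * fromℕ (suc j C suc k) * (s * S) * X
      ≡⟨ cong₂ (λ a c → a * c * (s * S) * X)
           (fromℕ-homo-+ (multichoose M (suc j)) (multichoose (suc M) j))
           (fromℕ-pascal j k) ⟩
    (P + Q) * (A + B) * (s * S) * X
      ≡⟨ solve 7 (λ P Q A B s S X → (P :+ Q) :* (A :+ B) :* (s :* S) :* X
                   := P :* (A :+ B) :* (s :* S) :* X :+ Q :* (s :* S) :* (B :* X) :+ s :* (Q :* A :* S :* X))
           refl P Q A B s S X ⟩
    P * (A + B) * (s * S) * X + Q * (s * S) * (B * X) + s * (Q * A * S * X)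
      ≡⟨ cong₂ (λ a b → P * a * (s * S) * X + Q * (s * S) * b + s * (Q * A * S * X))
           (sym (fromℕ-pascal j k)) (C-x^-shift j k) ⟩
    P * fromℕ (suc j C suc k) * (s * S) * X + Q * (s * S) * (x * (B * Y)) + s * (Q * A * S * X)
      ≡⟨ cong (λ t → P * fromℕ (suc j C suc k) * (s * S) * X + t + s * (Q * A * S * X))
           (solve 6 (λ Q s S x B Y → Q :* (s :* S) :* (x :* (B :* Y)) := x :* (Q :* B :* (s :* S) :* Y))
              refl Q s S x B Y) ⟩
    P * fromℕ (suc j C suc k) * (s * S) * X + x * (Q * B * (s * S) * Y) + s * (Q * A * S * X) ∎
    where
    open ≡-Reasoning
    P = fromℕ (multichoose M (suc j))
    Q = fromℕ (multichoose (suc M) j)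
    A = fromℕ (j C k)
    B = fromℕ (j C suc k)
    S = s ^ᵠ k
    X = x ^ᵠ (j ∸ k)
    Y = x ^ᵠ (j ∸ suc k)

  invDenomPoly^-suc : ∀ M n → invDenomPoly^ M (suc n) ≡ antidiagonal n (λ j → term M (suc j))
  invDenomPoly^-suc M n = antidiagonal-shift n (term M) (term-axis M)

  invDenomPoly^-zero : invDenomPoly^ 0 ≗ oneₛ
  invDenomPoly^-zero zero    = refl
  invDenomPoly^-zero (suc n) =
    trans (invDenomPoly^-suc 0 n) (sumUpTo-zero n _ (λ k _ → term-zero (n ∸ k) k))
    where
    term-zero : ∀ j k → term 0 (suc j) k ≡ 0ℚ
    term-zero j k = solve 3 (λ a b c → con 0ℚ :* a :* b :* c := con 0ℚ) refl
      (fromℕ (suc j C k)) (s ^ᵠ k) (x ^ᵠ (suc j ∸ k))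

  invDenomPoly^-*ₛ-denomPoly : ∀ M → (invDenomPoly^ (suc M) *ₛ denomPoly x s) ≗ invDenomPoly^ M
  invDenomPoly^-*ₛ-denomPoly M n =
    trans (*ₛ-comm f (denomPoly x s) n) (recurrence⇒denomPoly-*ₛ x s {f} {g} f₀ f₁ f₂₊ n)
    where
    open ≡-Reasoning
    f = invDenomPoly^ (suc M)
    g = invDenomPoly^ M
    f₀ : f 0 ≡ g 0
    f₀ = cong (λ a → fromℕ a * 1ℚ * 1ℚ * 1ℚ) (sym (multichoose-zeroʳ M))
    f₁ : f 1 ≡ g 1 + x * f 0
    f₁ = begin
      f 1                                  ≡⟨ invDenomPoly^-suc (suc M) 0 ⟩
      term (suc M) 1 0                     ≡⟨ term-pascal₀ M 0 ⟩
      term M 1 0 + x * term (suc M) 0 0    ≡⟨ cong (_+ x * f 0) (invDenomPoly^-suc M 0) ⟨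
      g 1 + x * f 0                        ∎
    f₂₊ : ∀ n → f (2 ℕ.+ n) ≡ g (2 ℕ.+ n) + x * f (1 ℕ.+ n) + s * f n
    f₂₊ n = begin
      f (2 ℕ.+ n)
        ≡⟨ trans (invDenomPoly^-suc (suc M) (suc n)) (antidiagonal-suc n (λ j → term (suc M) (suc j))) ⟩
      term (suc M) (2 ℕ.+ n) 0 + antidiagonal n (λ j k → term (suc M) (suc j) (suc k))
        ≡⟨ cong₂ _+_ (term-pascal₀ M (suc n)) (sumUpTo-cong n (λ k _ → term-pascal M (n ∸ k) k)) ⟩
      (a₀ + x * b₀)
        + antidiagonal n (λ j k → term M (suc j) (suc k) + x * term (suc M) j (suc k) + s * term (suc M) j k)
        ≡⟨ cong ((a₀ + x * b₀) +_) (trans (sumUpTo-+-* n s _ _) (cong (_+ s * f n) (sumUpTo-+-* n x _ _))) ⟩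
      (a₀ + x * b₀) + (a + x * b + s * f n)
        ≡⟨ solve 7 (λ a₀ b₀ a b c x s → (a₀ :+ x :* b₀) :+ (a :+ x :* b :+ s :* c)
                                       := (a₀ :+ a) :+ x :* (b₀ :+ b) :+ s :* c)
             refl a₀ b₀ a b (f n) x s ⟩
      (a₀ + a) + x * (b₀ + b) + s * f n
        ≡⟨ cong₂ (λ u v → u + x * v + s * f n)
             (sym (trans (invDenomPoly^-suc M (suc n)) (antidiagonal-suc n (λ j → term M (suc j)))))
             (sym (antidiagonal-suc n (term (suc M)))) ⟩
      g (2 ℕ.+ n) + x * f (1 ℕ.+ n) + s * f n ∎
      where
      a₀ = term M (2 ℕ.+ n) 0
      b₀ = term (suc M) (suc n) 0
      a = antidiagonal n (λ j k → term M (suc j) (suc k))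
      b = antidiagonal n (λ j k → term (suc M) j (suc k))

  invDenomPoly^-*ₛ-denomPoly^ : ∀ M → (invDenomPoly^ M *ₛ (denomPoly x s ^ₛ M)) ≗ oneₛ
  invDenomPoly^-*ₛ-denomPoly^ zero    n = trans (*ₛ-identityʳ (invDenomPoly^ 0) n) (invDenomPoly^-zero n)
  invDenomPoly^-*ₛ-denomPoly^ (suc M) = begin
    invDenomPoly^ (suc M) *ₛ (D *ₛ (D ^ₛ M))
      ≈⟨ *ₛ-assoc (invDenomPoly^ (suc M)) D (D ^ₛ M) ⟨
    (invDenomPoly^ (suc M) *ₛ D) *ₛ (D ^ₛ M)
      ≈⟨ *ₛ-cong {g = D ^ₛ M} (invDenomPoly^-*ₛ-denomPoly M) (λ _ → refl) ⟩
    invDenomPoly^ M *ₛ (D ^ₛ M)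
      ≈⟨ invDenomPoly^-*ₛ-denomPoly^ M ⟩
    oneₛ ∎
    where
    D = denomPoly x s
    open CommutativeMonoid *ₛ-oneₛ-commutativeMonoid using (setoid)
    open import Relation.Binary.Reasoning.Setoid setoid

  l-summand : ℕ → ℕ → ℕ → ℚ
  l-summand m n k = frac (n !) (k ! ℕ.* (n ∸ 2 ℕ.* k) !) * frac 1 (prodℕ k (λ j → suc (m ℕ.+ n) ∸ j))
    * s ^ᵠ k * x ^ᵠ (n ∸ 2 ℕ.* k)

  l-summand-*-binomial : ∀ m n k → k ℕ.+ k ≤ n →
    l-summand m n k * fromℕ ((n ℕ.+ m) C m) ≡ term (suc m) (n ∸ k) k
  l-summand-*-binomial m n k k+k≤n = begin
    F₁ * F₂ * S * x ^ᵠ (n ∸ 2 ℕ.* k) * c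
      ≡⟨ solve 5 (λ F₁ F₂ S X c → F₁ :* F₂ :* S :* X :* c := F₁ :* F₂ :* c :* S :* X)
           refl F₁ F₂ S (x ^ᵠ (n ∸ 2 ℕ.* k)) c ⟩
    F₁ * F₂ * c * S * x ^ᵠ (n ∸ 2 ℕ.* k)
      ≡⟨ cong₂ (λ a e → a * S * x ^ᵠ e) coefficient (n∸2k≡n∸k∸k n k) ⟩
    fromℕ (multichoose (suc m) (n ∸ k) ℕ.* ((n ∸ k) C k)) * S * x ^ᵠ ((n ∸ k) ∸ k)
      ≡⟨ cong (λ a → a * S * x ^ᵠ ((n ∸ k) ∸ k))
           (fromℕ-homo-* (multichoose (suc m) (n ∸ k)) ((n ∸ k) C k)) ⟩
    term (suc m) (n ∸ k) k ∎
    where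
    open ≡-Reasoning
    F₁ = frac (n !) (k ! ℕ.* (n ∸ 2 ℕ.* k) !)
    F₂ = frac 1 (prodℕ k (λ j → suc (m ℕ.+ n) ∸ j))
    S = s ^ᵠ k
    c = fromℕ ((n ℕ.+ m) C m)
    k≤m+n : k ℕ.≤ m ℕ.+ n
    k≤m+n = ℕ.≤-trans (ℕ.m≤m+n k k) (ℕ.≤-trans k+k≤n (ℕ.m≤n+m n m))
    coefficient : F₁ * F₂ * c ≡ fromℕ (multichoose (suc m) (n ∸ k) ℕ.* ((n ∸ k) C k))
    coefficient rewrite prodℕ-falling (m ℕ.+ n) k =
      frac-*-frac-*-fromℕ (n !) 1 ((n ℕ.+ m) C m) (multichoose (suc m) (n ∸ k) ℕ.* ((n ∸ k) C k))
        (k ! ℕ.* (n ∸ 2 ℕ.* k) !) ((m ℕ.+ n) P′ k)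
        {{ℕ.m*n≢0 (k !) ((n ∸ 2 ℕ.* k) !) {{k ℕ.!≢0}} {{(n ∸ 2 ℕ.* k) ℕ.!≢0}}}} {{nP′k≢0 k≤m+n}}
        (trans (cong (ℕ._* ((n ℕ.+ m) C m)) (ℕ.*-identityʳ (n !))) (binomial-falling-identity m n k k+k≤n))

  lhsSeries≗invDenomPoly^ : ∀ m → lhsSeries x (suc m) s ≗ invDenomPoly^ (suc m)
  lhsSeries≗invDenomPoly^ m n = begin
    l n x (suc m) s * fromℕ ((n ℕ.+ suc m ∸ 1) C m)
      ≡⟨ cong (λ i → l n x (suc m) s * fromℕ ((i ∸ 1) C m)) (ℕ.+-suc n m) ⟩
    l n x (suc m) s * fromℕ ((n ℕ.+ m) C m)
      ≡⟨ *-distribʳ-sumUpTo ⌊ n /2⌋ (fromℕ ((n ℕ.+ m) C m)) (l-summand m n) ⟩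
    sumUpTo ⌊ n /2⌋ (λ k → l-summand m n k * fromℕ ((n ℕ.+ m) C m))
      ≡⟨ sumUpTo-cong ⌊ n /2⌋ (λ k k≤n/2 → l-summand-*-binomial m n k (k≤⌊n/2⌋⇒k+k≤n k≤n/2)) ⟩
    sumUpTo ⌊ n /2⌋ (λ k → term (suc m) (n ∸ k) k)
      ≡⟨ sumUpTo-extend n (λ k → term (suc m) (n ∸ k) k) (ℕ.⌊n/2⌋≤n n) vanish ⟩
    invDenomPoly^ (suc m) n ∎
    where
    open ≡-Reasoning
    vanish : ∀ k → ⌊ n /2⌋ < k → k ≤ n → term (suc m) (n ∸ k) k ≡ 0ℚ
    vanish k n/2<k k≤n rewrite ⌊n/2⌋<k⇒[n∸k]Ck≡0 k≤n n/2<k =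
      solve 3 (λ a b c → a :* con 0ℚ :* b :* c := con 0ℚ) refl
        (fromℕ (multichoose (suc m) (n ∸ k))) (s ^ᵠ k) (x ^ᵠ ((n ∸ k) ∸ k))

  l1Series-*ₛ-denomPoly : (l1Series x s *ₛ denomPoly x s) ≗ oneₛ
  l1Series-*ₛ-denomPoly n = begin
    (l1Series x s *ₛ denomPoly x s) n      ≡⟨ *ₛ-cong {g = denomPoly x s} l1≗c₁ (λ _ → refl) n ⟩
    (invDenomPoly^ 1 *ₛ denomPoly x s) n   ≡⟨ invDenomPoly^-*ₛ-denomPoly 0 n ⟩
    invDenomPoly^ 0 n                      ≡⟨ invDenomPoly^-zero n ⟩
    oneₛ n                                 ∎
    where
    open ≡-Reasoning
    l1≗c₁ : l1Series x s ≗ invDenomPoly^ 1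
    l1≗c₁ n = trans (sym (*-identityʳ (l n x 1 s))) (lhsSeries≗invDenomPoly^ 0 n)

mainTheorem5 : (m : ℕ) → 0 < m → (x s : ℚ) →
    ((n : ℕ) → (lhsSeries x m s *ₛ (denomPoly x s ^ₛ m)) n ≡ oneₛ n)
    × ((n : ℕ) → lhsSeries x m s n ≡ (l1Series x s ^ₛ m) n)
mainTheorem5 (suc m) _ x s = lhs-inverse , lhs≗l1^
  where
  M = suc m
  D = denomPoly x s
  c-inverse : (invDenomPoly^ x s M *ₛ (D ^ₛ M)) ≗ oneₛ
  c-inverse = invDenomPoly^-*ₛ-denomPoly^ x s M
  l1^-inverse : ((l1Series x s ^ₛ M) *ₛ (D ^ₛ M)) ≗ oneₛ
  l1^-inverse = ^ₛ-*ₛ-inverse {l1Series x s} {D} M (l1Series-*ₛ-denomPoly x s)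
  lhs-inverse : (lhsSeries x M s *ₛ (D ^ₛ M)) ≗ oneₛ
  lhs-inverse n = trans (*ₛ-cong {g = D ^ₛ M} (lhsSeries≗invDenomPoly^ x s m) (λ _ → refl) n) (c-inverse n)
  lhs≗l1^ : lhsSeries x M s ≗ (l1Series x s ^ₛ M)
  lhs≗l1^ n = trans (lhsSeries≗invDenomPoly^ x s m n)
    (inverse-unique *ₛ-oneₛ-commutativeMonoid {invDenomPoly^ x s M} {l1Series x s ^ₛ M} {D ^ₛ M}
      c-inverse l1^-inverse n)
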